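{- Let $p$ be a prime. For every pair $d,m$ of positive integers there is a $\mathrm{pReLU}$-network of width $d+1$ (input dimension $d$, output dimension $1$) which computes, on $\mathbb Z_p^d$, an encoding function of type $(d,m)$.
   Context: $\mathbb Q_p$ denotes the $p$-adic numbers and $\mathbb Z_p$ the $p$-adic integers. An encoding function of type $(d,m)$ is a function $F:\mathbb Z_p^d\to\mathbb Z_p$ such that for all $x,y\in\mathbb Z_p^d$ we have $F(x)=F(y)$ if and only if $x-y\in p^m\mathbb Z_p^d$. The function $\mathrm{pReLU}:\mathbb Q_p\to\mathbb Q_p$ is defined by $\mathrm{pReLU}(x)=x$ if $x\in\mathbb Z_p$ and $0$ otherwise. A $\mathrm{pReLU}$-network with input dimension $d_x$, output dimension $d_y$ and hidden layer dimensions $d_1,\dots,d_{L-1}$ is a composition $t_L\circ\Sigma_{L-1}\circ t_{L-1}\circ\cdots\circ t_2\circ\Sigma_1\circ t_1:\mathbb Q_p^{d_x}\to\mathbb Q_p^{d_y}$, where (with $d_0=d_x$, $d_L=d_y$) each $t_l:\mathbb Q_p^{d_{l-1}}\to\mathbb Q_p^{d_l}$ is an affine map with coefficients in $\mathbb Q_p$ and $\Sigma_l$ applies $\mathrm{pReLU}$ to each coordinate. Its width is $\max(d_1,\dots,d_{L-1})$. A network computes a function on a set $X$ if its restriction to $X$ equals that function. -}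

module Defs where

open import Data.Nat as ℕ using (ℕ; zero; suc; _^_; _⊔_)
open import Data.Integer as ℤ using (ℤ; +_)
open import Data.Integer.Divisibility.Signed
  using (_∣_; _∣?_; ∣m∣n⇒∣m+n; ∣m⇒∣-m; ∣n⇒∣m*n; ∣m⇒∣m*n; ∣-refl)
open import Data.Integer.Solver using (module +-*-Solver)
open import Data.Fin using (Fin; zero; suc)
open import Data.Product using (_×_)
open import Relation.Nullary using (yes; no)
open import Relation.Binary.PropositionalEquality using (_≡_; refl; subst)

-- p-adic integers ℤ_p, as coherent sequences of integers
-- x = (x 0, x 1, x 2, ...) with x (n+1) ≡ x n (mod p^n); the element
-- represented is lim x n.

Div : ℕ → ℕ → ℤ → Set
Div p n z = (+ (p ^ n)) ∣ z

record ℤₚ (p : ℕ) : Set where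
  constructor mkℤₚ
  field
    seq : ℕ → ℤ
    coh : ∀ n → Div p n (seq (suc n) ℤ.- seq n)
open ℤₚ public

_≈ℤₚ_ : ∀ {p} → ℤₚ p → ℤₚ p → Set
_≈ℤₚ_ {p} x y = ∀ n → Div p n (seq x n ℤ.- seq y n)

InPowIdeal : ∀ {p} → ℕ → ℤₚ p → Set
InPowIdeal {p} m x = Div p m (seq x m)

private
  open +-*-Solver

  addEq : ∀ a b c d → (a ℤ.+ b) ℤ.- (c ℤ.+ d) ≡ (a ℤ.- c) ℤ.+ (b ℤ.- d)
  addEq = solve 4 (λ a b c d → (a :+ b) :- (c :+ d) := (a :- c) :+ (b :- d)) refl

  mulEq : ∀ a b c d → (a ℤ.* b) ℤ.- (c ℤ.* d) ≡ a ℤ.* (b ℤ.- d) ℤ.+ (a ℤ.- c) ℤ.* d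
  mulEq = solve 4 (λ a b c d → (a :* b) :- (c :* d) := a :* (b :- d) :+ (a :- c) :* d) refl

  negEq : ∀ a c → (ℤ.- a) ℤ.- (ℤ.- c) ≡ ℤ.- (a ℤ.- c)
  negEq = solve 2 (λ a c → (:- a) :- (:- c) := :- (a :- c)) refl

  constEq : ∀ c → c ℤ.- c ≡ ℤ.0ℤ
  constEq = solve 1 (λ c → c :- c := con ℤ.0ℤ) refl

_+ℤₚ_ : ∀ {p} → ℤₚ p → ℤₚ p → ℤₚ p
_+ℤₚ_ {p} x y = mkℤₚ (λ n → seq x n ℤ.+ seq y n) λ n →
  subst (Div p n)
    (Relation.Binary.PropositionalEquality.sym
      (addEq (seq x (suc n)) (seq y (suc n)) (seq x n) (seq y n)))
    (∣m∣n⇒∣m+n (coh x n) (coh y n))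

_*ℤₚ_ : ∀ {p} → ℤₚ p → ℤₚ p → ℤₚ p
_*ℤₚ_ {p} x y = mkℤₚ (λ n → seq x n ℤ.* seq y n) λ n →
  subst (Div p n)
    (Relation.Binary.PropositionalEquality.sym
      (mulEq (seq x (suc n)) (seq y (suc n)) (seq x n) (seq y n)))
    (∣m∣n⇒∣m+n (∣n⇒∣m*n (seq x (suc n)) (coh y n)) (∣m⇒∣m*n (seq y n) (coh x n)))

-ℤₚ_ : ∀ {p} → ℤₚ p → ℤₚ p
-ℤₚ_ {p} x = mkℤₚ (λ n → ℤ.- seq x n) λ n →
  subst (Div p n)
    (Relation.Binary.PropositionalEquality.sym (negEq (seq x (suc n)) (seq x n)))
    (∣m⇒∣-m (coh x n))

_-ℤₚ_ : ∀ {p} → ℤₚ p → ℤₚ p → ℤₚ p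
x -ℤₚ y = x +ℤₚ (-ℤₚ y)

fromℤ : ∀ {p} → ℤ → ℤₚ p
fromℤ {p} c = mkℤₚ (λ _ → c) λ n →
  subst (Div p n)
    (Relation.Binary.PropositionalEquality.sym (constEq c))
    (∣n⇒∣m*n ℤ.0ℤ (∣-refl {+ (p ^ n)}))

-- p-adic numbers ℚ_p: a pair (x , k) represents p^(-k) · x, x ∈ ℤ_p.

record ℚₚ (p : ℕ) : Set where
  constructor _/p^_
  field
    num : ℤₚ p
    den : ℕ
open ℚₚ public

pow : ∀ {p} → ℕ → ℤₚ p
pow {p} k = fromℤ (+ (p ^ k))

_≈_ : ∀ {p} → ℚₚ p → ℚₚ p → Set
(x /p^ k) ≈ (y /p^ l) = (pow l *ℤₚ x) ≈ℤₚ (pow k *ℤₚ y)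

_+ₚ_ : ∀ {p} → ℚₚ p → ℚₚ p → ℚₚ p
(x /p^ k) +ₚ (y /p^ l) = ((pow l *ℤₚ x) +ℤₚ (pow k *ℤₚ y)) /p^ (k ℕ.+ l)

_*ₚ_ : ∀ {p} → ℚₚ p → ℚₚ p → ℚₚ p
(x /p^ k) *ₚ (y /p^ l) = (x *ℤₚ y) /p^ (k ℕ.+ l)

0ₚ : ∀ {p} → ℚₚ p
0ₚ = fromℤ ℤ.0ℤ /p^ 0

ι : ∀ {p} → ℤₚ p → ℚₚ p
ι x = x /p^ 0

Integral : ∀ {p} → ℚₚ p → Set
Integral (x /p^ k) = InPowIdeal k x

pReLU : ∀ {p} → ℚₚ p → ℚₚ p
pReLU {p} (x /p^ k) with (+ (p ^ k)) ∣? seq x k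
... | yes _ = x /p^ k
... | no  _ = 0ₚ

Vecₚ : ℕ → ℕ → Set
Vecₚ p n = Fin n → ℚₚ p

sumₚ : ∀ {p} n → (Fin n → ℚₚ p) → ℚₚ p
sumₚ zero    f = 0ₚ
sumₚ (suc n) f = f zero +ₚ sumₚ n (λ i → f (suc i))

record Affine (p a b : ℕ) : Set where
  constructor affine
  field
    W : Fin b → Fin a → ℚₚ p
    c : Fin b → ℚₚ p
open Affine public

applyAffine : ∀ {p a b} → Affine p a b → Vecₚ p a → Vecₚ p b
applyAffine {a = a} t v j = c t j +ₚ sumₚ a (λ i → W t j i *ₚ v i)

-- a network t_L ∘ Σ ∘ t_{L-1} ∘ ⋯ ∘ Σ ∘ t_1 from dimension a to dimension b
data Net (p : ℕ) : ℕ → ℕ → Set where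
  last  : ∀ {a b} → Affine p a b → Net p a b
  layer : ∀ {a h b} → Affine p a h → Net p h b → Net p a b

eval : ∀ {p a b} → Net p a b → Vecₚ p a → Vecₚ p b
eval (last t)    v = applyAffine t v
eval (layer t N) v = eval N (λ i → pReLU (applyAffine t v i))

width : ∀ {p a b} → Net p a b → ℕ
width (last t) = 0
width (layer {h = h} t N) = h ⊔ width N

CongMod : ∀ {p d} → ℕ → (Fin d → ℤₚ p) → (Fin d → ℤₚ p) → Set
CongMod m x y = ∀ i → InPowIdeal m (x i -ℤₚ y i)

ComputesEncoding : ∀ {p d} → ℕ → Net p d 1 → Set
ComputesEncoding {p} {d} m N =
  ((x : Fin d → ℤₚ p) → Integral (eval N (λ i → ι (x i)) zero)) ×
  ((x y : Fin d → ℤₚ p) →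
     (eval N (λ i → ι (x i)) zero ≈ eval N (λ i → ι (y i)) zero → CongMod m x y) ×
     (CongMod m x y → eval N (λ i → ι (x i)) zero ≈ eval N (λ i → ι (y i)) zero))

module Submission where

-- Coordinate 0 of every hidden layer is a scratch register; the other d coordinates hold a vector y,
-- initially x.  For every pair (k, a) with a < p^m there is one hidden layer: it writes (y_k - a)/p^m
-- into the register, pReLU keeps this value exactly when y_k ≡ a (mod p^m), and the next affine map
-- subtracts p^m times the register from y_k.  As y_k ≡ x_k (mod p^m) throughout and residues below
-- p^m are unique, y_k becomes the residue r_k of x_k at the step (k, r_k) and is left alone by all
-- other steps.  The output layer returns the integer Σ_k p^(mk) r_k, whose base-p^m digits are the
-- residues, so it determines and is determined by x mod p^m.

open import Defs
open import Data.Nat using (ℕ; suc; NonZero)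
open import Data.Nat.Primality using (Prime; prime⇒nonZero; prime⇒nonTrivial)
open import Data.Product using (Σ; _×_; _,_; proj₂)
open import Relation.Binary.PropositionalEquality using (_≡_)

open import Data.Nat as ℕ using (zero; _^_)
import Data.Nat.Properties as ℕ
import Data.Nat.Divisibility as ℕ
open import Data.Integer
  using (ℤ; +_; 0ℤ; 1ℤ; _+_; _*_; _-_; -_; ∣_∣; _%ℕ_; _/ℕ_)
open import Data.Integer.Properties
  using (+-*-semiring; pos-*; +-inverseʳ; +-identityˡ; +-identityʳ; +-comm;
         *-identityʳ; *-identityˡ; *-zeroʳ; *-assoc; *-cancelʳ-≡; i-j≡0⇒i≡j; +-injective;
         ∣i∣≡0⇒i≡0; ∣m⊝n∣≤m⊔n; m-n≡m⊖n)
open import Data.Integer.DivMod using (n%ℕd<d; a≡a%ℕn+[a/ℕn]*n)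
open import Data.Integer.Divisibility.Signed
  using (_∣_; divides; _∣?_; ∣-trans; ∣⇒∣ᵤ; ∣m∣n⇒∣m+n; ∣m∣n⇒∣m-n; ∣n⇒∣m*n;
         *-monoʳ-∣; *-cancelˡ-∣)
open import Data.Integer.Tactic.RingSolver using (solve-∀)
open import Algebra.Properties.Semiring.Sum +-*-semiring
  using (sum-syntax; sum-cong-≗; sum-replicate-zero; ∑-comm; *-distribˡ-sum; *-distribʳ-sum)
open import Data.Fin using (Fin; zero; suc; toℕ; _≟_)
import Data.Vec.Functional as Vector
open import Data.Sum using (_⊎_; inj₁; inj₂)
open import Data.List using (List; []; _∷_; upTo; allFin; cartesianProduct)
open import Data.List.Relation.Unary.All as All using (All; []; _∷_)
open import Data.List.Relation.Unary.Any using (here; there)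
open import Data.List.Membership.Propositional using (_∈_)
open import Data.List.Membership.Propositional.Properties
  using (∈-cartesianProduct⁺; ∈-cartesianProduct⁻; ∈-allFin; ∈-upTo⁺; ∈-upTo⁻)
open import Function using (_∘_)
open import Relation.Nullary using (¬_; Dec; yes; no; contradiction)
open import Relation.Binary.PropositionalEquality
  using (_≢_; refl; sym; trans; cong; cong₂; subst; module ≡-Reasoning)

-- Residues and digits in base M

multiple<⇒≡0 : ∀ {M z} → + M ∣ z → ∣ z ∣ ℕ.< M → z ≡ 0ℤ
multiple<⇒≡0 {M} {z} M∣z |z|<M with ∣ z ∣ in |z|≡ | ∣⇒∣ᵤ M∣z
... | zero  | _       = ∣i∣≡0⇒i≡0 |z|≡
... | suc _ | M∣suc = contradiction (ℕ.∣⇒≤ M∣suc) (ℕ.<⇒≱ |z|<M)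

residue-unique : ∀ {M a b} → a ℕ.< M → b ℕ.< M → + M ∣ (+ a - + b) → a ≡ b
residue-unique {M} {a} {b} a<M b<M M∣a-b =
  +-injective (i-j≡0⇒i≡j (+ a) (+ b) (multiple<⇒≡0 M∣a-b |a-b|<M))
  where
  |a-b|<M : ∣ + a - + b ∣ ℕ.< M
  |a-b|<M = ℕ.≤-<-trans
    (subst (λ z → ∣ z ∣ ℕ.≤ a ℕ.⊔ b) (sym (m-n≡m⊖n a b)) (∣m⊝n∣≤m⊔n a b)) (ℕ.⊔-lub a<M b<M)

∣-%ℕ : ∀ z M .{{_ : NonZero M}} → + M ∣ (z - + (z %ℕ M))
∣-%ℕ z M = divides (z /ℕ M) (begin
    z - r                        ≡⟨ cong (_- r) (a≡a%ℕn+[a/ℕn]*n z M) ⟩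
    (r + (z /ℕ M) * + M) - r     ≡⟨ cancel r (z /ℕ M * + M) ⟩
    z /ℕ M * + M                 ∎)
  where
  open ≡-Reasoning
  r = + (z %ℕ M)
  cancel : ∀ a b → (a + b) - a ≡ b
  cancel = solve-∀

%ℕ-≡⇒∣ : ∀ z w M .{{_ : NonZero M}} → z %ℕ M ≡ w %ℕ M → + M ∣ (z - w)
%ℕ-≡⇒∣ z w M eq = subst (+ M ∣_) (telescope z w (+ (w %ℕ M)))
  (∣m∣n⇒∣m-n (subst (λ r → + M ∣ (z - + r)) eq (∣-%ℕ z M)) (∣-%ℕ w M))
  where
  telescope : ∀ a b r → (a - r) - (b - r) ≡ a - b
  telescope = solve-∀

∣⇒%ℕ-≡ : ∀ z w M .{{_ : NonZero M}} → + M ∣ (z - w) → z %ℕ M ≡ w %ℕ M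
∣⇒%ℕ-≡ z w M M∣z-w = residue-unique (n%ℕd<d z M) (n%ℕd<d w M)
  (subst (+ M ∣_) (telescope z w (+ (z %ℕ M)) (+ (w %ℕ M)))
    (∣m∣n⇒∣m+n (∣m∣n⇒∣m-n M∣z-w (∣-%ℕ z M)) (∣-%ℕ w M)))
  where
  telescope : ∀ a b r s → ((a - b) - (a - r)) + (b - s) ≡ r - s
  telescope = solve-∀

digitsValue : ∀ M n → (Fin n → ℕ) → ℤ
digitsValue M n f = ∑[ l < n ] (+ (M ^ toℕ l) * + f l)

digitsValue-suc : ∀ M n (f : Fin (suc n) → ℕ) →
  digitsValue M (suc n) f ≡ + f zero + + M * digitsValue M n (λ l → f (suc l))
digitsValue-suc M n f = cong₂ _+_ (*-identityˡ (+ f zero)) (begin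
    ∑[ l < n ] (+ (M ℕ.* M ^ toℕ l) * + f (suc l))   ≡⟨ sum-cong-≗ shift ⟩
    ∑[ l < n ] (+ M * (+ (M ^ toℕ l) * + f (suc l))) ≡⟨ sym (*-distribˡ-sum {n} (+ M) _) ⟩
    + M * digitsValue M n (λ l → f (suc l))          ∎)
  where
  open ≡-Reasoning
  shift : ∀ l → + (M ℕ.* M ^ toℕ l) * + f (suc l) ≡ + M * (+ (M ^ toℕ l) * + f (suc l))
  shift l = trans (cong (_* + f (suc l)) (pos-* M (M ^ toℕ l))) (*-assoc (+ M) _ _)

digitsValue-injective : ∀ M .{{_ : NonZero M}} n (f g : Fin n → ℕ) →
  (∀ l → f l ℕ.< M) → (∀ l → g l ℕ.< M) →
  digitsValue M n f ≡ digitsValue M n g → ∀ l → f l ≡ g l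
digitsValue-injective M (suc n) f g f<M g<M eq = digit
  where
  u = digitsValue M n (λ l → f (suc l))
  v = digitsValue M n (λ l → g (suc l))
  shifted : ∀ a b u v → a + + M * u ≡ b + + M * v → a - b ≡ (v - u) * + M
  shifted a b u v h = begin
    a - b                                            ≡⟨ regroup a b u v (+ M) ⟩
    ((a + + M * u) - (b + + M * v)) + (v - u) * + M  ≡⟨ cong (λ t → (t - (b + + M * v)) + (v - u) * + M) h ⟩
    ((b + + M * v) - (b + + M * v)) + (v - u) * + M  ≡⟨ cong (_+ (v - u) * + M) (+-inverseʳ (b + + M * v)) ⟩
    0ℤ + (v - u) * + M                               ≡⟨ +-identityˡ _ ⟩
    (v - u) * + M                                    ∎
    where
    open ≡-Reasoning
    regroup : ∀ a b u v m → a - b ≡ ((a + m * u) - (b + m * v)) + (v - u) * m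
    regroup = solve-∀
  split : + f zero - + g zero ≡ (v - u) * + M
  split = shifted (+ f zero) (+ g zero) u v
    (trans (sym (digitsValue-suc M n f)) (trans eq (digitsValue-suc M n g)))
  head : f zero ≡ g zero
  head = residue-unique (f<M zero) (g<M zero) (divides (v - u) split)
  tail : u ≡ v
  tail = sym (i-j≡0⇒i≡j v u (*-cancelʳ-≡ (v - u) 0ℤ (+ M)
           (trans (sym split) (trans (cong (λ t → + t - + g zero) head) (+-inverseʳ (+ g zero))))))
  digit : ∀ l → f l ≡ g l
  digit zero    = head
  digit (suc l) = digitsValue-injective M n (λ l → f (suc l)) (λ l → g (suc l))
                    (λ l → f<M (suc l)) (λ l → g<M (suc l)) tail l

n<m^n : ∀ {m} → 1 ℕ.< m → ∀ n → n ℕ.< m ^ n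
n<m^n 1<m zero    = ℕ.s≤s ℕ.z≤n
n<m^n {m} 1<m (suc n) = ℕ.≤-<-trans (n<m^n 1<m n) (ℕ.^-monoʳ-< m 1<m (ℕ.n<1+n n))

δ : ∀ {n} → Fin n → Fin n → ℤ
δ zero    zero    = 1ℤ
δ zero    (suc _) = 0ℤ
δ (suc _) zero    = 0ℤ
δ (suc i) (suc j) = δ i j

δ-refl : ∀ {n} (i : Fin n) → δ i i ≡ 1ℤ
δ-refl zero    = refl
δ-refl (suc i) = δ-refl i

δ-≢ : ∀ {n} {i j : Fin n} → i ≢ j → δ i j ≡ 0ℤ
δ-≢ {i = zero}  {zero}  i≢j = contradiction refl i≢j
δ-≢ {i = zero}  {suc j} i≢j = refl
δ-≢ {i = suc i} {zero}  i≢j = refl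
δ-≢ {i = suc i} {suc j} i≢j = δ-≢ (λ i≡j → i≢j (cong suc i≡j))

∑-δ : ∀ {n} (f : Fin n → ℤ) j → ∑[ i < n ] (δ i j * f i) ≡ f j
∑-δ {suc n} f zero    =
  trans (cong₂ _+_ (*-identityˡ (f zero)) (sum-replicate-zero n)) (+-identityʳ (f zero))
∑-δ {suc n} f (suc j) = trans (+-identityˡ _) (∑-δ (λ i → f (suc i)) j)

-- Divisibility by powers of p and equality of p-adic numbers

module PAdic (p : ℕ) .{{_ : NonZero p}} where

  p^ : ℕ → ℤ
  p^ n = + (p ^ n)

  p^-+ : ∀ k n → p^ (k ℕ.+ n) ≡ p^ k * p^ n
  p^-+ k n = trans (cong +_ (ℕ.^-distribˡ-+-* p k n)) (pos-* (p ^ k) (p ^ n))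

  ≡⇒Div : ∀ n a {b} → a ≡ b → Div p n (a - b)
  ≡⇒Div n a refl = subst (Div p n) (sym (+-inverseʳ a)) (divides 0ℤ refl)

  Div-weaken : ∀ k n {z} → Div p (k ℕ.+ n) z → Div p n z
  Div-weaken k n = ∣-trans (divides (p^ k) (p^-+ k n))

  Div-*ˡ : ∀ k n {z} → Div p n z → Div p (k ℕ.+ n) (p^ k * z)
  Div-*ˡ k n {z} p^n∣z = subst (_∣ p^ k * z) (sym (p^-+ k n)) (*-monoʳ-∣ (p^ k) p^n∣z)

  Div-*ˡ-cancel : ∀ k n {z} → Div p (k ℕ.+ n) (p^ k * z) → Div p n z
  Div-*ˡ-cancel k n {z} p^k+n∣p^kz =
    *-cancelˡ-∣ (p^ k) {{ℕ.m^n≢0 p k}} (subst (_∣ p^ k * z) (p^-+ k n) p^k+n∣p^kz)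

  seq-coherent : ∀ (x : ℤₚ p) j n → Div p n (seq x (j ℕ.+ n) - seq x n)
  seq-coherent x zero    n = ≡⇒Div n (seq x n) refl
  seq-coherent x (suc j) n = subst (Div p n) (telescope (seq x (suc j ℕ.+ n)) (seq x (j ℕ.+ n)) (seq x n))
    (∣m∣n⇒∣m+n (Div-weaken j n (coh x (j ℕ.+ n))) (seq-coherent x j n))
    where
    telescope : ∀ a b c → (a - b) + (b - c) ≡ a - c
    telescope = solve-∀

  InPowIdeal⇒Div-later : ∀ (x : ℤₚ p) j n → InPowIdeal n x → Div p n (seq x (j ℕ.+ n))
  InPowIdeal⇒Div-later x j n p^n∣xₙ = subst (Div p n) (telescope (seq x (j ℕ.+ n)) (seq x n))
    (∣m∣n⇒∣m+n (seq-coherent x j n) p^n∣xₙ)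
    where
    telescope : ∀ a b → (a - b) + b ≡ a
    telescope = solve-∀

  Div-later⇒InPowIdeal : ∀ (x : ℤₚ p) j n → Div p n (seq x (j ℕ.+ n)) → InPowIdeal n x
  Div-later⇒InPowIdeal x j n p^n∣xⱼ₊ₙ = subst (Div p n) (telescope (seq x (j ℕ.+ n)) (seq x n))
    (∣m∣n⇒∣m-n p^n∣xⱼ₊ₙ (seq-coherent x j n))
    where
    telescope : ∀ a b → a - (a - b) ≡ b
    telescope = solve-∀

  -- Read p^(l+n) ∣ p^l xₗ₊ₙ at the later index l + n and cancel p^l.
  p^l*x≈0⇒x≈0 : ∀ l (x : ℤₚ p) → (∀ n → Div p n (p^ l * seq x n)) → ∀ n → InPowIdeal n x
  p^l*x≈0⇒x≈0 l x p^l*x≡0 n =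
    Div-later⇒InPowIdeal x l n (Div-*ˡ-cancel l n (p^l*x≡0 (l ℕ.+ n)))

  Div-lincomb : ∀ n a b {x y z} → z ≡ a * x + b * y → Div p n x → Div p n y → Div p n z
  Div-lincomb n a b eq p^n∣x p^n∣y =
    subst (Div p n) (sym eq) (∣m∣n⇒∣m+n (∣n⇒∣m*n a p^n∣x) (∣n⇒∣m*n b p^n∣y))

  infix 4 _≋_ _≃_

  -- Records rather than the bare relations of Defs, so that Agda can infer the compared values.
  -- Even so, implicit arguments are often supplied by hand below: inferring them by unification
  -- makes Agda unfold the coherence proofs inside ℤₚ, and type checking then does not finish.
  record _≋_ (x y : ℤₚ p) : Set where
    constructor mk≋
    field ≋⇒≈ℤₚ : x ≈ℤₚ y
  open _≋_ public

  record _≃_ (q r : ℚₚ p) : Set where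
    constructor mk≃
    field ≃⇒≈ : q ≈ r
  open _≃_ public

  ≋-pointwise : ∀ {x y} → (∀ n → seq x n ≡ seq y n) → x ≋ y
  ≋-pointwise {x} eq = mk≋ λ n → ≡⇒Div n (seq x n) (eq n)

  ≋-trans : ∀ {x y z} → x ≋ y → y ≋ z → x ≋ z
  ≋-trans {x} {y} {z} (mk≋ x≈y) (mk≋ y≈z) = mk≋ λ n →
    Div-lincomb n 1ℤ 1ℤ (telescope (seq x n) (seq y n) (seq z n)) (x≈y n) (y≈z n)
    where
    telescope : ∀ a b c → a - c ≡ 1ℤ * (a - b) + 1ℤ * (b - c)
    telescope = solve-∀

  ∑ₚ : ∀ n → (Fin n → ℤₚ p) → ℤₚ p
  ∑ₚ zero    f = fromℤ 0ℤ
  ∑ₚ (suc n) f = f zero +ℤₚ ∑ₚ n (λ i → f (suc i))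

  seq-∑ₚ : ∀ n (f : Fin n → ℤₚ p) t → seq (∑ₚ n f) t ≡ ∑[ i < n ] seq (f i) t
  seq-∑ₚ zero    f t = refl
  seq-∑ₚ (suc n) f t = cong (λ s → seq (f zero) t + s) (seq-∑ₚ n (λ i → f (suc i)) t)

  ∑ₚ-cong-*ˡ : ∀ n (c : Fin n → ℤ) {x y : Fin n → ℤₚ p} → (∀ i → x i ≋ y i) →
    ∑ₚ n (λ i → fromℤ (c i) *ℤₚ x i) ≋ ∑ₚ n (λ i → fromℤ (c i) *ℤₚ y i)
  ∑ₚ-cong-*ˡ zero    c x≋y = ≋-pointwise λ t → refl
  ∑ₚ-cong-*ˡ (suc n) c {x} {y} x≋y = mk≋ λ t →
    Div-lincomb t (c zero) 1ℤ (regroup (c zero) (seq (x zero) t) (seq (y zero) t) _ _)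
      (≋⇒≈ℤₚ (x≋y zero) t) (≋⇒≈ℤₚ (∑ₚ-cong-*ˡ n (λ i → c (suc i)) (λ i → x≋y (suc i))) t)
    where
    regroup : ∀ c a b s s′ → (c * a + s) - (c * b + s′) ≡ c * (a - b) + 1ℤ * (s - s′)
    regroup = solve-∀

  ≃-pointwise : ∀ {x k y l} → (∀ n → p^ l * seq x n ≡ p^ k * seq y n) → x /p^ k ≃ y /p^ l
  ≃-pointwise {x} {l = l} eq = mk≃ λ n → ≡⇒Div n (p^ l * seq x n) (eq n)

  ≃-refl : ∀ {q} → q ≃ q
  ≃-refl {x /p^ k} = ≃-pointwise λ n → refl

  ≃-sym : ∀ {q r} → q ≃ r → r ≃ q
  ≃-sym {x /p^ k} {y /p^ l} (mk≃ q≈r) = mk≃ λ n →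
    Div-lincomb n (- 1ℤ) 0ℤ (negate (p^ k * seq y n) (p^ l * seq x n)) (q≈r n) (q≈r n)
    where
    negate : ∀ a b → a - b ≡ - 1ℤ * (b - a) + 0ℤ * (b - a)
    negate = solve-∀

  -- With E = p^j x - p^k z we have p^l E = p^j (p^l x - p^k y) + p^k (p^j y - p^l z).
  ≃-trans : ∀ {q r s} → q ≃ r → r ≃ s → q ≃ s
  ≃-trans {x /p^ k} {y /p^ l} {z /p^ j} (mk≃ q≈r) (mk≃ r≈s) =
    mk≃ (p^l*x≈0⇒x≈0 l ((pow j *ℤₚ x) -ℤₚ (pow k *ℤₚ z)) λ n →
      Div-lincomb n (p^ j) (p^ k) (regroup (p^ j) (p^ k) (p^ l) (seq x n) (seq y n) (seq z n))
        (q≈r n) (r≈s n))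
    where
    regroup : ∀ a b c x y z → c * (a * x - b * z) ≡ a * (c * x - b * y) + b * (a * y - c * z)
    regroup = solve-∀

  +ₚ-cong : ∀ {q q′ r r′} → q ≃ q′ → r ≃ r′ → (q +ₚ r) ≃ (q′ +ₚ r′)
  +ₚ-cong {x /p^ k} {x′ /p^ k′} {y /p^ l} {y′ /p^ l′} (mk≃ q≈q′) (mk≃ r≈r′) = mk≃ λ n →
    Div-lincomb n (p^ l * p^ l′) (p^ k * p^ k′) (begin
      p^ (k′ ℕ.+ l′) * (p^ l * seq x n + p^ k * seq y n) - p^ (k ℕ.+ l) * (p^ l′ * seq x′ n + p^ k′ * seq y′ n)
        ≡⟨ cong₂ (λ a b → a * (p^ l * seq x n + p^ k * seq y n) - b * (p^ l′ * seq x′ n + p^ k′ * seq y′ n))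
                 (p^-+ k′ l′) (p^-+ k l) ⟩
      (p^ k′ * p^ l′) * (p^ l * seq x n + p^ k * seq y n) - (p^ k * p^ l) * (p^ l′ * seq x′ n + p^ k′ * seq y′ n)
        ≡⟨ regroup (p^ k) (p^ k′) (p^ l) (p^ l′) (seq x n) (seq x′ n) (seq y n) (seq y′ n) ⟩
      (p^ l * p^ l′) * (p^ k′ * seq x n - p^ k * seq x′ n) + (p^ k * p^ k′) * (p^ l′ * seq y n - p^ l * seq y′ n) ∎)
      (q≈q′ n) (r≈r′ n)
    where
    open ≡-Reasoning
    regroup : ∀ a a′ b b′ x x′ y y′ →
      (a′ * b′) * (b * x + a * y) - (a * b) * (b′ * x′ + a′ * y′) ≡
      (b * b′) * (a′ * x - a * x′) + (a * a′) * (b′ * y - b * y′)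
    regroup = solve-∀

  *ₚ-cong : ∀ {q q′ r r′} → q ≃ q′ → r ≃ r′ → (q *ₚ r) ≃ (q′ *ₚ r′)
  *ₚ-cong {x /p^ k} {x′ /p^ k′} {y /p^ l} {y′ /p^ l′} (mk≃ q≈q′) (mk≃ r≈r′) = mk≃ λ n →
    Div-lincomb n (p^ l′ * seq y n) (p^ k * seq x′ n) (begin
      p^ (k′ ℕ.+ l′) * (seq x n * seq y n) - p^ (k ℕ.+ l) * (seq x′ n * seq y′ n)
        ≡⟨ cong₂ (λ a b → a * (seq x n * seq y n) - b * (seq x′ n * seq y′ n)) (p^-+ k′ l′) (p^-+ k l) ⟩
      (p^ k′ * p^ l′) * (seq x n * seq y n) - (p^ k * p^ l) * (seq x′ n * seq y′ n)
        ≡⟨ regroup (p^ k) (p^ k′) (p^ l) (p^ l′) (seq x n) (seq x′ n) (seq y n) (seq y′ n) ⟩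
      (p^ l′ * seq y n) * (p^ k′ * seq x n - p^ k * seq x′ n) + (p^ k * seq x′ n) * (p^ l′ * seq y n - p^ l * seq y′ n) ∎)
      (q≈q′ n) (r≈r′ n)
    where
    open ≡-Reasoning
    regroup : ∀ a a′ b b′ x x′ y y′ →
      (a′ * b′) * (x * y) - (a * b) * (x′ * y′) ≡
      (b′ * y) * (a′ * x - a * x′) + (a * x′) * (b′ * y - b * y′)
    regroup = solve-∀

  -- p^l xₗ₊ₖ and hence p^k yₗ₊ₖ are divisible by p^(l+k); cancel p^k and move back to index l.
  Integral-cong : ∀ {q r} → q ≃ r → Integral q → Integral r
  Integral-cong {x /p^ k} {y /p^ l} (mk≃ q≈r) p^k∣xₖ =
    Div-later⇒InPowIdeal y k l
      (Div-*ˡ-cancel k l (subst (λ n → Div p n (p^ k * seq y n)) (ℕ.+-comm l k) p^l+k∣p^ky))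
    where
    p^l+k∣p^ky : Div p (l ℕ.+ k) (p^ k * seq y (l ℕ.+ k))
    p^l+k∣p^ky = Div-lincomb (l ℕ.+ k) 1ℤ (- 1ℤ) (regroup (p^ l * seq x (l ℕ.+ k)) (p^ k * seq y (l ℕ.+ k)))
      (Div-*ˡ l k (InPowIdeal⇒Div-later x l k p^k∣xₖ)) (q≈r (l ℕ.+ k))
      where
      regroup : ∀ a b → b ≡ 1ℤ * a + - 1ℤ * (a - b)
      regroup = solve-∀

  /p^-cong : ∀ e x y → x ≋ y → x /p^ e ≃ y /p^ e
  /p^-cong e x y (mk≋ x≈y) = mk≃ λ n →
    Div-lincomb n (p^ e) 0ℤ (regroup (p^ e) (seq x n) (seq y n)) (x≈y n) (x≈y n)
    where
    regroup : ∀ c a b → c * a - c * b ≡ c * (a - b) + 0ℤ * (a - b)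
    regroup = solve-∀

  ι-integral : ∀ (x : ℤₚ p) → Integral (ι x)
  ι-integral x = divides (seq x 0) (sym (*-identityʳ (seq x 0)))

  ι-injective : ∀ x y → ι x ≃ ι y → x ≋ y
  ι-injective x y (mk≃ x≈y) = mk≋ λ n →
    subst (Div p n) (cong₂ _-_ (*-identityˡ (seq x n)) (*-identityˡ (seq y n))) (x≈y n)

  fromℤ-injective : 1 ℕ.< p → ∀ {a b} → fromℤ a ≋ fromℤ b → a ≡ b
  fromℤ-injective 1<p {a} {b} (mk≋ a≈b) =
    i-j≡0⇒i≡j a b (multiple<⇒≡0 (a≈b ∣ a - b ∣) (n<m^n 1<p ∣ a - b ∣))

  0ₚ≃0/p^ : ∀ e → 0ₚ ≃ fromℤ 0ℤ /p^ e
  0ₚ≃0/p^ e = ≃-pointwise λ n → trans (*-zeroʳ (p^ e)) (sym (*-zeroʳ (p^ 0)))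

  /p^-+ : ∀ e x y → ((x /p^ e) +ₚ (y /p^ e)) ≃ (x +ℤₚ y) /p^ e
  /p^-+ e x y = ≃-pointwise λ n → begin
    p^ e * (p^ e * seq x n + p^ e * seq y n) ≡⟨ regroup (p^ e) (seq x n) (seq y n) ⟩
    (p^ e * p^ e) * (seq x n + seq y n)      ≡⟨ cong (_* (seq x n + seq y n)) (sym (p^-+ e e)) ⟩
    p^ (e ℕ.+ e) * (seq x n + seq y n)       ∎
    where
    open ≡-Reasoning
    regroup : ∀ c a b → c * (c * a + c * b) ≡ (c * c) * (a + b)
    regroup = solve-∀

  pReLU-integral : ∀ q → Integral q → pReLU q ≃ q
  pReLU-integral (x /p^ k) p^k∣xₖ with + (p ^ k) ∣? seq x k
  ... | yes _        = ≃-refl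
  ... | no ¬p^k∣xₖ = contradiction p^k∣xₖ ¬p^k∣xₖ

  pReLU-nonintegral : ∀ q → ¬ Integral q → pReLU q ≃ 0ₚ
  pReLU-nonintegral (x /p^ k) ¬p^k∣xₖ with + (p ^ k) ∣? seq x k
  ... | yes p^k∣xₖ = contradiction p^k∣xₖ ¬p^k∣xₖ
  ... | no _         = ≃-refl

  pReLU-fixes : ∀ q r → q ≃ r → Integral r → pReLU q ≃ r
  pReLU-fixes q r q≃r r-int = ≃-trans (pReLU-integral q (Integral-cong (≃-sym q≃r) r-int)) q≃r

  -- Opaque, so that conversion checking never evaluates the divisibility test.
  opaque
    keepMultiple : ℕ → ℤₚ p → ℤₚ p
    keepMultiple n x with + (p ^ n) ∣? seq x n
    ... | yes _ = x
    ... | no _  = fromℤ 0ℤ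

    keepMultiple-InPowIdeal : ∀ n x → InPowIdeal n (keepMultiple n x)
    keepMultiple-InPowIdeal n x with + (p ^ n) ∣? seq x n
    ... | yes p^n∣xₙ = p^n∣xₙ
    ... | no _        = divides 0ℤ refl

    keepMultiple-multiple : ∀ n x → InPowIdeal n x → keepMultiple n x ≡ x
    keepMultiple-multiple n x p^n∣xₙ with + (p ^ n) ∣? seq x n
    ... | yes _        = refl
    ... | no ¬p^n∣xₙ = contradiction p^n∣xₙ ¬p^n∣xₙ

    keepMultiple-nonmultiple : ∀ n x → ¬ InPowIdeal n x → keepMultiple n x ≡ fromℤ 0ℤ
    keepMultiple-nonmultiple n x ¬p^n∣xₙ with + (p ^ n) ∣? seq x n
    ... | yes p^n∣xₙ = contradiction p^n∣xₙ ¬p^n∣xₙ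
    ... | no _         = refl

  pReLU-/p^ : ∀ q n x → q ≃ x /p^ n → pReLU q ≃ keepMultiple n x /p^ n
  pReLU-/p^ q n x q≃x with + (p ^ n) ∣? seq x n
  ... | yes p^n∣xₙ = subst (λ u → pReLU q ≃ u /p^ n) (sym (keepMultiple-multiple n x p^n∣xₙ))
    (pReLU-fixes q (x /p^ n) q≃x p^n∣xₙ)
  ... | no ¬p^n∣xₙ = subst (λ u → pReLU q ≃ u /p^ n) (sym (keepMultiple-nonmultiple n x ¬p^n∣xₙ))
    (≃-trans (pReLU-nonintegral q λ q-int → ¬p^n∣xₙ (Integral-cong q≃x q-int)) (0ₚ≃0/p^ n))

  -- Affine maps on scaled inputs

  -- Row j has denominator p^(e j) and column i expects inputs of denominator p^(s i);
  -- the factor p^(s i) in the weight cancels the latter, so all arithmetic is in ℤ.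
  scaledAffine : ∀ {a b} (e : Fin b → ℕ) (s : Fin a → ℕ) (C : Fin b → ℤ) (w : Fin b → Fin a → ℤ) →
    Affine p a b
  scaledAffine e s C w = affine (λ j i → fromℤ (w j i * p^ (s i)) /p^ e j) (λ j → fromℤ (C j) /p^ e j)

  *ₚ-cancel-p^ : ∀ e s c x → ((fromℤ (c * p^ s) /p^ e) *ₚ (x /p^ s)) ≃ (fromℤ c *ℤₚ x) /p^ e
  *ₚ-cancel-p^ e s c x = ≃-pointwise λ n → begin
    p^ e * ((c * p^ s) * seq x n) ≡⟨ regroup (p^ e) (p^ s) c (seq x n) ⟩
    (p^ e * p^ s) * (c * seq x n) ≡⟨ cong (_* (c * seq x n)) (sym (p^-+ e s)) ⟩
    p^ (e ℕ.+ s) * (c * seq x n)  ∎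
    where
    open ≡-Reasoning
    regroup : ∀ a b c x → a * ((c * b) * x) ≡ (a * b) * (c * x)
    regroup = solve-∀

  *ₚ-scaled : ∀ e s c {W h} x → W ≃ fromℤ (c * p^ s) /p^ e → h ≃ x /p^ s →
    (W *ₚ h) ≃ (fromℤ c *ℤₚ x) /p^ e
  *ₚ-scaled e s c {W} {h} x W≃ h≃x =
    ≃-trans (*ₚ-cong {W} {fromℤ (c * p^ s) /p^ e} {h} {x /p^ s} W≃ h≃x) (*ₚ-cancel-p^ e s c x)

  sumₚ-scaled : ∀ {n} e (w : Fin n → ℤ) (s : Fin n → ℕ) (W h : Fin n → ℚₚ p) (x : Fin n → ℤₚ p) →
    (∀ i → W i ≃ fromℤ (w i * p^ (s i)) /p^ e) → (∀ i → h i ≃ x i /p^ (s i)) →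
    sumₚ n (λ i → W i *ₚ h i) ≃ ∑ₚ n (λ i → fromℤ (w i) *ℤₚ x i) /p^ e
  sumₚ-scaled {zero}  e w s W h x W≃ h≃x = 0ₚ≃0/p^ e
  sumₚ-scaled {suc n} e w s W h x W≃ h≃x = ≃-trans
    (+ₚ-cong {W zero *ₚ h zero} {(fromℤ (w zero) *ℤₚ x zero) /p^ e}
             {sumₚ n (λ i → W (suc i) *ₚ h (suc i))} {∑ₚ n (λ i → fromℤ (w (suc i)) *ℤₚ x (suc i)) /p^ e}
      (*ₚ-scaled e (s zero) (w zero) (x zero) (W≃ zero) (h≃x zero))
      (sumₚ-scaled e (λ i → w (suc i)) (λ i → s (suc i)) (λ i → W (suc i)) (λ i → h (suc i)) (λ i → x (suc i))
         (λ i → W≃ (suc i)) (λ i → h≃x (suc i))))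
    (/p^-+ e (fromℤ (w zero) *ℤₚ x zero) (∑ₚ n (λ i → fromℤ (w (suc i)) *ℤₚ x (suc i))))

  -- Stated for any A equal to a scaled map, so that the conclusion mentions the named layer A itself.
  applyAffine-scaled : ∀ {a b} (A : Affine p a b) e s C w → A ≡ scaledAffine e s C w →
    (h : Fin a → ℚₚ p) (x : Fin a → ℤₚ p) → (∀ i → h i ≃ x i /p^ (s i)) →
    ∀ j y → (∀ t → C j + ∑[ i < a ] (w j i * seq (x i) t) ≡ seq y t) → applyAffine A h j ≃ y /p^ e j
  applyAffine-scaled {a} _ e s C w refl h x h≃x j y eq = ≃-trans
    (+ₚ-cong {c (scaledAffine e s C w) j} {fromℤ (C j) /p^ e j}
             {sumₚ a (λ i → W (scaledAffine e s C w) j i *ₚ h i)}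
             {∑ₚ a (λ i → fromℤ (w j i) *ℤₚ x i) /p^ e j}
      ≃-refl (sumₚ-scaled (e j) (w j) s (W (scaledAffine e s C w) j) h x (λ i → ≃-refl) h≃x))
    (≃-trans (/p^-+ (e j) (fromℤ (C j)) (∑ₚ a (λ i → fromℤ (w j i) *ℤₚ x i)))
             (/p^-cong (e j) (fromℤ (C j) +ℤₚ ∑ₚ a (λ i → fromℤ (w j i) *ℤₚ x i)) y
               (≋-pointwise λ t → trans (cong (λ σ → C j + σ) (seq-∑ₚ a (λ i → fromℤ (w j i) *ℤₚ x i) t))
                                        (eq t))))

  -- The encoding network

  module Encoder (m d : ℕ) where

    B : ℕ
    B = p ^ m

    instance
      B≢0 : NonZero B
      B≢0 = ℕ.m^n≢0 p m

    subtractAt : Fin d → ℤₚ p → (Fin d → ℤₚ p) → Fin d → ℤₚ p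
    subtractAt k u y j = y j -ℤₚ (fromℤ (δ j k) *ℤₚ u)

    subtractAt-≢ : ∀ k u y j → j ≢ k → subtractAt k u y j ≋ y j
    subtractAt-≢ k u y j j≢k = ≋-pointwise λ t → drop (seq (y j) t) (δ j k) (seq u t) (δ-≢ j≢k)
      where
      drop : ∀ a d b → d ≡ 0ℤ → a - d * b ≡ a
      drop a d b refl = drop-zero a b
        where
        drop-zero : ∀ a b → a - 0ℤ * b ≡ a
        drop-zero = solve-∀

    subtractAt-0 : ∀ k u y j → u ≡ fromℤ 0ℤ → subtractAt k u y j ≋ y j
    subtractAt-0 k _ y j refl = ≋-pointwise λ t → drop-zero (seq (y j) t) (δ j k)
      where
      drop-zero : ∀ a d → a - d * 0ℤ ≡ a
      drop-zero = solve-∀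

    subtractAt-self : ∀ k u v y → u ≡ y k -ℤₚ v → subtractAt k u y k ≋ v
    subtractAt-self k _ v y refl = ≋-pointwise λ t → cancel (seq (y k) t) (δ k k) (seq v t) (δ-refl k)
      where
      cancel : ∀ a d b → d ≡ 1ℤ → a - d * (a - b) ≡ b
      cancel a d b refl = cancel-one a b
        where
        cancel-one : ∀ a b → a - 1ℤ * (a - b) ≡ b
        cancel-one = solve-∀

    -- If y k ≡ a (mod p^m), then y k is replaced by a; otherwise y is unchanged.
    reduceAt : Fin d → ℕ → (Fin d → ℤₚ p) → Fin d → ℤₚ p
    reduceAt k a y = subtractAt k (keepMultiple m (y k -ℤₚ fromℤ (+ a))) y

    -- The step is written out instead of as reduceAt k a y; both are definitionally equal, but only
    -- this form matches the evaluation of the network syntactically, which keeps type checking fast.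
    reduceAlong : List (Fin d × ℕ) → (Fin d → ℤₚ p) → Fin d → ℤₚ p
    reduceAlong []              y = y
    reduceAlong ((k , a) ∷ ka) y = reduceAlong ka (subtractAt k (keepMultiple m (y k -ℤₚ fromℤ (+ a))) y)

    allSteps : List (Fin d × ℕ)
    allSteps = cartesianProduct (allFin d) (upTo B)

    module _ (r : Fin d → ℕ) (r<B : ∀ j → r j ℕ.< B) where

      HasResidues : (Fin d → ℤₚ p) → Set
      HasResidues y = ∀ j → Div p m (seq (y j) m - + r j)

      Reduced : (Fin d → ℤₚ p) → Fin d → Set
      Reduced y j = y j ≋ fromℤ (+ r j)

      reduceAt-residues : ∀ y k a → HasResidues y → HasResidues (reduceAt k a y)
      reduceAt-residues y k a y≡r j =
        Div-lincomb m 1ℤ (- δ j k) (regroup (seq (y j) m) (δ j k) (seq u m) (+ r j))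
          (y≡r j) (keepMultiple-InPowIdeal m (y k -ℤₚ fromℤ (+ a)))
        where
        u = keepMultiple m (y k -ℤₚ fromℤ (+ a))
        regroup : ∀ y d u r → (y - d * u) - r ≡ 1ℤ * (y - r) + - d * u
        regroup = solve-∀

      reduceAt-hit : ∀ y k → HasResidues y → Reduced (reduceAt k (r k) y) k
      reduceAt-hit y k y≡r = subtractAt-self k (keepMultiple m (y k -ℤₚ fromℤ (+ r k))) (fromℤ (+ r k)) y
        (keepMultiple-multiple m (y k -ℤₚ fromℤ (+ r k)) (y≡r k))

      residue-mismatch : ∀ y j a → HasResidues y → a ℕ.< B → a ≢ r j → ¬ Div p m (seq (y j) m - + a)
      residue-mismatch y j a y≡r a<B a≢r y≡a = a≢r (residue-unique a<B (r<B j)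
        (subst (Div p m) (regroup (seq (y j) m) (+ a) (+ r j)) (∣m∣n⇒∣m-n (y≡r j) y≡a)))
        where
        regroup : ∀ y a r → (y - r) - (y - a) ≡ a - r
        regroup = solve-∀

      reduceAt-other : ∀ y k a j → j ≢ k → reduceAt k a y j ≋ y j
      reduceAt-other y k a j = subtractAt-≢ k (keepMultiple m (y k -ℤₚ fromℤ (+ a))) y j

      reduceAt-nonresidue : ∀ y a j → HasResidues y → a ℕ.< B → a ≢ r j → reduceAt j a y j ≋ y j
      reduceAt-nonresidue y a j y≡r a<B a≢r = subtractAt-0 j (keepMultiple m (y j -ℤₚ fromℤ (+ a))) y j
        (keepMultiple-nonmultiple m (y j -ℤₚ fromℤ (+ a)) (residue-mismatch y j a y≡r a<B a≢r))

      -- The two decisions are arguments because a with-abstraction would normalise the goal.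
      reduceAt-reduced : ∀ y k a j → HasResidues y → a ℕ.< B → Dec (j ≡ k) → Dec (a ≡ r j) →
        Reduced y j → Reduced (reduceAt k a y) j
      reduceAt-reduced y k a j y≡r a<B (no j≢k)    _          y-red =
        ≋-trans {reduceAt k a y j} {y j} {fromℤ (+ r j)} (reduceAt-other y k a j j≢k) y-red
      reduceAt-reduced y k .(r k) .k y≡r a<B (yes refl) (yes refl) y-red = reduceAt-hit y k y≡r
      reduceAt-reduced y k a .k y≡r a<B (yes refl) (no a≢r)   y-red =
        ≋-trans {reduceAt k a y k} {y k} {fromℤ (+ r k)} (reduceAt-nonresidue y a k y≡r a<B a≢r) y-red

      reduceAlong-reduces : ∀ ka y j → HasResidues y → All ((ℕ._< B) ∘ proj₂) ka →
        (j , r j) ∈ ka ⊎ Reduced y j → Reduced (reduceAlong ka y) j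
      reduceAlong-reduces []              y j y≡r []            (inj₂ y-red)         = y-red
      reduceAlong-reduces ((k , a) ∷ ka) y j y≡r (a<B ∷ ka<B) (inj₁ (here refl))  =
        reduceAlong-reduces ka (reduceAt k a y) j (reduceAt-residues y k a y≡r) ka<B
          (inj₂ (reduceAt-hit y j y≡r))
      reduceAlong-reduces ((k , a) ∷ ka) y j y≡r (a<B ∷ ka<B) (inj₁ (there j,r∈ka)) =
        reduceAlong-reduces ka (reduceAt k a y) j (reduceAt-residues y k a y≡r) ka<B (inj₁ j,r∈ka)
      reduceAlong-reduces ((k , a) ∷ ka) y j y≡r (a<B ∷ ka<B) (inj₂ y-red)         =
        reduceAlong-reduces ka (reduceAt k a y) j (reduceAt-residues y k a y≡r) ka<B
          (inj₂ (reduceAt-reduced y k a j y≡r a<B (j ≟ k) (a ℕ.≟ r j) y-red))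

      reduceAlong-allSteps : ∀ y → HasResidues y → ∀ j → Reduced (reduceAlong allSteps y) j
      reduceAlong-allSteps y y≡r j = reduceAlong-reduces allSteps y j y≡r
        (All.tabulate λ step∈ → ∈-upTo⁻ (proj₂ (∈-cartesianProduct⁻ (allFin d) (upTo B) step∈)))
        (inj₁ (∈-cartesianProduct⁺ (∈-allFin j) (∈-upTo⁺ (r<B j))))


    scale : Fin (suc d) → ℕ
    scale zero    = m
    scale (suc _) = 0

    -- Coordinate 0 of a hidden layer is a scratch register holding u / p^m.  The next layer
    -- reads the state as the vector subtractAt k u x, where k is the coordinate tested last.
    Represents : (Fin (suc d) → ℚₚ p) → ℤₚ p → (Fin d → ℤₚ p) → Set
    Represents h u x = ∀ i → h i ≃ (u Vector.∷ x) i /p^ scale i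

    readRow : Fin d → Fin d → Fin (suc d) → ℤ
    readRow k j zero    = - δ j k
    readRow k j (suc l) = δ l j

    readRow-value : ∀ k j u x t →
      ∑[ i < suc d ] (readRow k j i * seq ((u Vector.∷ x) i) t) ≡ seq (subtractAt k u x j) t
    readRow-value k j u x t =
      trans (cong (λ σ → - δ j k * seq u t + σ) (∑-δ (λ l → seq (x l) t) j))
            (swap (δ j k) (seq u t) (seq (x j) t))
      where
      swap : ∀ d u x → - d * u + x ≡ x - d * u
      swap = solve-∀

    loadRow : Fin (suc d) → Fin d → ℤ
    loadRow zero    l = 0ℤ
    loadRow (suc j) l = δ l j

    load : Affine p d (suc d)
    load = scaledAffine scale (λ _ → 0) (λ _ → 0ℤ) loadRow

    load-represents : ∀ x → Represents (λ i → pReLU (applyAffine load (λ l → ι (x l)) i)) (fromℤ 0ℤ) x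
    load-represents x zero    = pReLU-fixes (applyAffine load (λ l → ι (x l)) zero) (fromℤ 0ℤ /p^ m)
      (applyAffine-scaled load scale (λ _ → 0) (λ _ → 0ℤ) loadRow refl (λ l → ι (x l)) x (λ l → ≃-refl)
        zero (fromℤ 0ℤ)
        λ t → trans (+-identityˡ _) (sum-replicate-zero d))
      (divides 0ℤ refl)
    load-represents x (suc j) = pReLU-fixes (applyAffine load (λ l → ι (x l)) (suc j)) (ι (x j))
      (applyAffine-scaled load scale (λ _ → 0) (λ _ → 0ℤ) loadRow refl (λ l → ι (x l)) x (λ l → ≃-refl)
        (suc j) (x j)
        λ t → trans (+-identityˡ _) (∑-δ (λ l → seq (x l) t) j))
      (ι-integral (x j))

    testConst : ℕ → Fin (suc d) → ℤ
    testConst a zero    = - + a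
    testConst a (suc _) = 0ℤ

    testRows : Fin d → Fin d → Fin (suc d) → Fin (suc d) → ℤ
    testRows k k₁ zero    = readRow k k₁
    testRows k k₁ (suc j) = readRow k j

    testLayer : Fin d → Fin d → ℕ → Affine p (suc d) (suc d)
    testLayer k k₁ a = scaledAffine scale scale (testConst a) (testRows k k₁)

    testLayer-represents : ∀ h u x k k₁ a → Represents h u x →
      Represents (λ i → pReLU (applyAffine (testLayer k k₁ a) h i))
                 (keepMultiple m (subtractAt k u x k₁ -ℤₚ fromℤ (+ a))) (subtractAt k u x)
    testLayer-represents h u x k k₁ a h≃ zero    =
      pReLU-/p^ (applyAffine (testLayer k k₁ a) h zero) m (subtractAt k u x k₁ -ℤₚ fromℤ (+ a))
        (applyAffine-scaled (testLayer k k₁ a) scale scale (testConst a) (testRows k k₁) refl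
          h (u Vector.∷ x) h≃ zero (subtractAt k u x k₁ -ℤₚ fromℤ (+ a)) λ t →
            trans (cong (λ σ → - + a + σ) (readRow-value k k₁ u x t)) (+-comm (- + a) _))
    testLayer-represents h u x k k₁ a h≃ (suc j) =
      pReLU-fixes (applyAffine (testLayer k k₁ a) h (suc j)) (ι (subtractAt k u x j))
        (applyAffine-scaled (testLayer k k₁ a) scale scale (testConst a) (testRows k k₁) refl
          h (u Vector.∷ x) h≃ (suc j) (subtractAt k u x j) λ t →
            trans (+-identityˡ _) (readRow-value k j u x t))
        (ι-integral (subtractAt k u x j))

    encode : (Fin d → ℤₚ p) → ℤₚ p
    encode y = ∑ₚ d (λ j → fromℤ (+ (B ^ toℕ j)) *ℤₚ y j)

    readoutRow : Fin d → Fin (suc d) → ℤ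
    readoutRow k i = ∑[ j < d ] (+ (B ^ toℕ j) * readRow k j i)

    readout : Fin d → Affine p (suc d) 1
    readout k = scaledAffine (λ _ → 0) scale (λ _ → 0ℤ) (λ _ → readoutRow k)

    readout-value : ∀ h u x k → Represents h u x →
      applyAffine (readout k) h zero ≃ ι (encode (subtractAt k u x))
    readout-value h u x k h≃ =
      applyAffine-scaled (readout k) (λ _ → 0) scale (λ _ → 0ℤ) (λ _ → readoutRow k) refl
        h (u Vector.∷ x) h≃ zero (encode (subtractAt k u x)) λ t → begin
        0ℤ + ∑[ i < suc d ] (readoutRow k i * s i t)
          ≡⟨ +-identityˡ _ ⟩
        ∑[ i < suc d ] (∑[ j < d ] (base j * readRow k j i) * s i t)
          ≡⟨ sum-cong-≗ (λ i → trans (*-distribʳ-sum {d} (s i t) (λ j → base j * readRow k j i))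
                                         (sum-cong-≗ λ j → *-assoc (base j) (readRow k j i) (s i t))) ⟩
        ∑[ i < suc d ] ∑[ j < d ] (base j * (readRow k j i * s i t))
          ≡⟨ ∑-comm (λ i j → base j * (readRow k j i * s i t)) ⟩
        ∑[ j < d ] ∑[ i < suc d ] (base j * (readRow k j i * s i t))
          ≡⟨ sum-cong-≗ (λ j → sym (*-distribˡ-sum {suc d} (base j) (λ i → readRow k j i * s i t))) ⟩
        ∑[ j < d ] (base j * ∑[ i < suc d ] (readRow k j i * s i t))
          ≡⟨ sum-cong-≗ (λ j → cong (base j *_) (readRow-value k j u x t)) ⟩
        ∑[ j < d ] (base j * seq (subtractAt k u x j) t)
          ≡⟨ sym (seq-∑ₚ d (λ j → fromℤ (base j) *ℤₚ subtractAt k u x j) t) ⟩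
        seq (encode (subtractAt k u x)) t ∎
      where
      open ≡-Reasoning
      base : Fin d → ℤ
      base j = + (B ^ toℕ j)
      s : Fin (suc d) → ℕ → ℤ
      s i = seq ((u Vector.∷ x) i)

    build : Fin d → List (Fin d × ℕ) → Net p (suc d) 1
    build k []               = last (readout k)
    build k ((k₁ , a) ∷ ka) = layer (testLayer k k₁ a) (build k₁ ka)

    eval-build : ∀ ka k h u x → Represents h u x →
      eval (build k ka) h zero ≃ ι (encode (reduceAlong ka (subtractAt k u x)))
    eval-build []               k h u x h≃ = readout-value h u x k h≃
    eval-build ((k₁ , a) ∷ ka) k h u x h≃ =
      eval-build ka k₁ (λ i → pReLU (applyAffine (testLayer k k₁ a) h i))
        (keepMultiple m (subtractAt k u x k₁ -ℤₚ fromℤ (+ a))) (subtractAt k u x)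
        (testLayer-represents h u x k k₁ a h≃)

    width-build : ∀ k ka → width (build k ka) ℕ.≤ suc d
    width-build k []               = ℕ.z≤n
    width-build k ((k₁ , a) ∷ ka) = ℕ.⊔-lub ℕ.≤-refl (width-build k₁ ka)

    encoderNet : Fin d → Net p d 1
    encoderNet k = layer load (build k allSteps)

    width-encoderNet : ∀ k → width (encoderNet k) ≡ suc d
    width-encoderNet k = ℕ.m≥n⇒m⊔n≡m (width-build k allSteps)

    residues : (Fin d → ℤₚ p) → Fin d → ℕ
    residues x j = seq (x j) m %ℕ B

    residues<B : ∀ x j → residues x j ℕ.< B
    residues<B x j = n%ℕd<d (seq (x j) m) B

    encode-reduced : ∀ k x →
      encode (reduceAlong allSteps (subtractAt k (fromℤ 0ℤ) x)) ≋ fromℤ (digitsValue B d (residues x))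
    encode-reduced k x =
      ≋-trans {encode (reduceAlong allSteps (subtractAt k (fromℤ 0ℤ) x))}
              {∑ₚ d (λ j → fromℤ (+ (B ^ toℕ j)) *ℤₚ fromℤ (+ residues x j))}
              {fromℤ (digitsValue B d (residues x))}
        (∑ₚ-cong-*ˡ d (λ j → + (B ^ toℕ j)) {reduceAlong allSteps (subtractAt k (fromℤ 0ℤ) x)}
          {λ j → fromℤ (+ residues x j)}
          (reduceAlong-allSteps (residues x) (residues<B x) (subtractAt k (fromℤ 0ℤ) x) x≡r))
        (≋-pointwise (seq-∑ₚ d (λ j → fromℤ (+ (B ^ toℕ j)) *ℤₚ fromℤ (+ residues x j))))
      where
      x≡r : HasResidues (residues x) (residues<B x) (subtractAt k (fromℤ 0ℤ) x)
      x≡r j = subst (λ z → Div p m (z - + residues x j)) (sym (drop-zero (seq (x j) m) (δ j k)))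
                    (∣-%ℕ (seq (x j) m) B)
        where
        drop-zero : ∀ y d → y - d * 0ℤ ≡ y
        drop-zero = solve-∀

    eval-encoderNet : ∀ k x →
      eval (encoderNet k) (λ i → ι (x i)) zero ≃ ι (fromℤ (digitsValue B d (residues x)))
    eval-encoderNet k x =
      ≃-trans {eval (encoderNet k) (λ i → ι (x i)) zero}
              {ι (encode (reduceAlong allSteps (subtractAt k (fromℤ 0ℤ) x)))}
              {ι (fromℤ (digitsValue B d (residues x)))}
        (eval-build allSteps k (λ i → pReLU (applyAffine load (λ l → ι (x l)) i)) (fromℤ 0ℤ) x (load-represents x))
        (/p^-cong 0 (encode (reduceAlong allSteps (subtractAt k (fromℤ 0ℤ) x))) (fromℤ (digitsValue B d (residues x)))
          (encode-reduced k x))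

    encoderNet-encodes : 1 ℕ.< p → ∀ k → ComputesEncoding m (encoderNet k)
    encoderNet-encodes 1<p k = integral , λ x y → sound x y , complete x y
      where
      integral : ∀ x → Integral (eval (encoderNet k) (λ i → ι (x i)) zero)
      integral x = Integral-cong {ι (fromℤ (digitsValue B d (residues x)))} {eval (encoderNet k) (λ i → ι (x i)) zero}
        (≃-sym {eval (encoderNet k) (λ i → ι (x i)) zero} {ι (fromℤ (digitsValue B d (residues x)))} (eval-encoderNet k x))
        (ι-integral (fromℤ (digitsValue B d (residues x))))

      sound : ∀ x y → eval (encoderNet k) (λ i → ι (x i)) zero ≈ eval (encoderNet k) (λ i → ι (y i)) zero →
        CongMod m x y
      sound x y Ex≈Ey i = %ℕ-≡⇒∣ (seq (x i) m) (seq (y i) m) B (same-residues i)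
        where
        same-value : ι (fromℤ (digitsValue B d (residues x))) ≃ ι (fromℤ (digitsValue B d (residues y)))
        same-value =
          ≃-trans {ι (fromℤ (digitsValue B d (residues x)))} {eval (encoderNet k) (λ i → ι (x i)) zero}
                  {ι (fromℤ (digitsValue B d (residues y)))}
            (≃-sym {eval (encoderNet k) (λ i → ι (x i)) zero} {ι (fromℤ (digitsValue B d (residues x)))}
              (eval-encoderNet k x))
            (≃-trans {eval (encoderNet k) (λ i → ι (x i)) zero} {eval (encoderNet k) (λ i → ι (y i)) zero}
                     {ι (fromℤ (digitsValue B d (residues y)))}
              (mk≃ Ex≈Ey) (eval-encoderNet k y))
        same-digits : digitsValue B d (residues x) ≡ digitsValue B d (residues y)
        same-digits = fromℤ-injective 1<p (ι-injective (fromℤ (digitsValue B d (residues x)))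
          (fromℤ (digitsValue B d (residues y))) same-value)
        same-residues : ∀ i → residues x i ≡ residues y i
        same-residues = digitsValue-injective B d (residues x) (residues y) (residues<B x) (residues<B y)
          same-digits

      complete : ∀ x y → CongMod m x y →
        eval (encoderNet k) (λ i → ι (x i)) zero ≈ eval (encoderNet k) (λ i → ι (y i)) zero
      complete x y x≡y = ≃⇒≈ {eval (encoderNet k) (λ i → ι (x i)) zero} {eval (encoderNet k) (λ i → ι (y i)) zero}
        (≃-trans {eval (encoderNet k) (λ i → ι (x i)) zero}
          {ι (fromℤ (digitsValue B d (residues y)))} {eval (encoderNet k) (λ i → ι (y i)) zero}
        (subst (λ v → eval (encoderNet k) (λ i → ι (x i)) zero ≃ ι (fromℤ v)) same-digits (eval-encoderNet k x))
        (≃-sym {eval (encoderNet k) (λ i → ι (y i)) zero} {ι (fromℤ (digitsValue B d (residues y)))}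
          (eval-encoderNet k y)))
        where
        same-digits : digitsValue B d (residues x) ≡ digitsValue B d (residues y)
        same-digits = sum-cong-≗ λ i →
          cong (λ r → + (B ^ toℕ i) * + r) (∣⇒%ℕ-≡ (seq (x i) m) (seq (y i) m) B (x≡y i))

lemma3p12 : (p : ℕ) → Prime p → (d m : ℕ) → NonZero d → NonZero m →
    Σ (Net p d 1) (λ N → (width N ≡ suc d) × ComputesEncoding m N)
lemma3p12 p p-prime (suc d) m _ _ =
  encoderNet zero , width-encoderNet zero , encoderNet-encodes 1<p zero
  where
  instance
    p≢0 : NonZero p
    p≢0 = prime⇒nonZero p-prime
  1<p : 1 ℕ.< p
  1<p = ℕ.nonTrivial⇒n>1 p {{prime⇒nonTrivial p-prime}}
  open PAdic.Encoder p m (suc d)
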